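{- Let $p>1$ be an odd integer and let $A_p$ be the set of all positive integers of the form $2^{x}p^{y}$ with $x,y$ non-negative integers. Then there exists a finite set $S\subset A_p\setminus\{1\}$ with the following four properties: 1. $S$ contains every power of two $2^j$ with $j\ge 1$ and $2^j\le |S|$. 2. There is a positive integer $M_0\le p$ such that every integer $x$ with $M_0\le x\le M_0+|S|$ can be written as a sum of distinct elements of $S$. 3. $|S|\le 1+\lceil \log_2 p\rceil$. 4. $p\le \max S\le 2^{\lceil \log_2 p\rceil}$.
   Context: The paper phrases property 1 as "$S$ contains all even powers of two smaller than or equal to $|S|$", where "even powers of two" means powers of two that are even numbers, i.e. $2,4,8,\dots$. -}

module Defs where

open import Data.Nat using (ℕ; _≡ᵇ_; _^_; _*_; _⊔_; _+_)
open import Data.List using (List; foldr)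
open import Data.Nat.ListAction using (sum)
open import Data.List.Relation.Binary.Sublist.Propositional using (_⊆_)
open import Data.Product using (Σ; ∃; ∃-syntax; _×_)
open import Relation.Binary.PropositionalEquality using (_≡_)

InA : ℕ → ℕ → Set
InA p n = ∃[ x ] ∃[ y ] (n ≡ 2 ^ x * p ^ y)

maxList : List ℕ → ℕ
maxList = foldr _⊔_ 0

-- n is a sum of distinct elements of S (S is a duplicate-free list):
-- sum of some sub-list (subsequence) of S
SumOfDistinct : List ℕ → ℕ → Set
SumOfDistinct S n = ∃[ T ] (T ⊆ S × sum T ≡ n)

-- Take S = p ∷ [2^k, …, 2], where k = ⌈log₂ p⌉, and write p = 1 + 2q. Since
-- p ≤ 2^k and k < 2^k, every x with 2q ≤ x ≤ 2q + |S| = p + k is below 2^(k+1).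
-- If x = 2m is even then m < 2^k, and doubling the binary expansion of m writes
-- x as a sum of distinct powers 2, …, 2^k; if x is odd then x = p + 2r with
-- 2r ≤ k, and p plus the doubled binary expansion of r gives x.
module Submission where

open import Defs
open import Data.Nat
  using (ℕ; zero; suc; _≤_; _<_; _+_; _*_; _^_; z≤n; s≤s; s≤s⁻¹; z<s; ⌊_/2⌋; ⌈_/2⌉; _<?_)
open import Data.Nat.Properties
open import Data.Nat.Logarithm using (⌈log₂_⌉)
open import Data.Nat.Logarithm.Core using (⌈log2⌉)
open import Data.Nat.Divisibility using (_∣_; m∣m*n)
open import Induction.WellFounded using (Acc; acc)
open import Relation.Nullary using (¬_; yes; no; contradiction)
open import Data.List using (List; []; _∷_; length)
open import Data.List.Relation.Unary.All using (All; []; _∷_)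
open import Data.List.Relation.Unary.Any using (here; there)
open import Data.List.Relation.Unary.Unique.Propositional using (Unique)
open import Data.List.Relation.Unary.AllPairs using ([]; _∷_)
open import Data.List.Relation.Binary.Sublist.Propositional using ([]; _∷_; _∷ʳ_)
open import Data.List.Membership.Propositional using (_∈_)
open import Data.Product using (∃-syntax; _×_; _,_)
open import Data.Sum using (_⊎_; inj₁; inj₂)
open import Function using (_∘_)
open import Relation.Binary.PropositionalEquality
  using (_≡_; _≢_; refl; sym; trans; cong; subst)

2*m≡m+m : ∀ m → 2 * m ≡ m + m
2*m≡m+m m = cong (m +_) (+-identityʳ m)

n<2^n : ∀ n → n < 2 ^ n
n<2^n zero = z<s
n<2^n (suc n) = +-mono-≤ (m^n>0 2 n) (≤-trans (n<2^n n) (m≤m+n (2 ^ n) 0))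

n≤2*⌈n/2⌉ : ∀ n → n ≤ 2 * ⌈ n /2⌉
n≤2*⌈n/2⌉ n = begin
  n                  ≡⟨ ⌊n/2⌋+⌈n/2⌉≡n n ⟨
  ⌊ n /2⌋ + ⌈ n /2⌉  ≤⟨ +-monoˡ-≤ ⌈ n /2⌉ (⌊n/2⌋≤⌈n/2⌉ n) ⟩
  ⌈ n /2⌉ + ⌈ n /2⌉  ≡⟨ 2*m≡m+m ⌈ n /2⌉ ⟨
  2 * ⌈ n /2⌉        ∎
  where open ≤-Reasoning

n≤2^⌈log2⌉n : ∀ n (rec : Acc _<_ n) → n ≤ 2 ^ ⌈log2⌉ n rec
n≤2^⌈log2⌉n 0 _ = z≤n
n≤2^⌈log2⌉n 1 _ = s≤s z≤n
-- ⌈ suc (suc m) /2⌉ is definitionally the argument suc ⌈ m /2⌉ of the recursive call.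
n≤2^⌈log2⌉n n@(suc (suc m)) (acc rs) =
  ≤-trans (n≤2*⌈n/2⌉ n) (*-monoʳ-≤ 2 (n≤2^⌈log2⌉n ⌈ n /2⌉ (rs (⌈n/2⌉<n m))))

n≤2^⌈log₂n⌉ : ∀ n → n ≤ 2 ^ ⌈log₂ n ⌉
n≤2^⌈log₂n⌉ n = n≤2^⌈log2⌉n n _

even⊎odd : ∀ n → ∃[ m ] (n ≡ 2 * m ⊎ n ≡ suc (2 * m))
even⊎odd zero = 0 , inj₁ refl
even⊎odd (suc n) with even⊎odd n
... | m , inj₁ refl = m , inj₂ refl
... | m , inj₂ refl = suc m , inj₁ (sym (*-suc 2 m))

¬2∣⇒odd : ∀ {n} → ¬ (2 ∣ n) → ∃[ m ] (n ≡ suc (2 * m))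
¬2∣⇒odd {n} 2∤n with even⊎odd n
... | m , inj₁ refl = contradiction (m∣m*n m) 2∤n
... | m , inj₂ n≡1+2m = m , n≡1+2m

InA-self : ∀ p → InA p p
InA-self p = 0 , 1 , sym (trans (+-identityʳ (p * 1)) (*-identityʳ p))

InA-2^ : ∀ p n → InA p (2 ^ n)
InA-2^ p n = n , 0 , sym (*-identityʳ (2 ^ n))

twoPowers : ℕ → List ℕ
twoPowers zero = []
twoPowers (suc n) = 2 ^ suc n ∷ twoPowers n

length-twoPowers : ∀ n → length (twoPowers n) ≡ n
length-twoPowers zero = refl
length-twoPowers (suc n) = cong suc (length-twoPowers n)

All-twoPowers : ∀ {P : ℕ → Set} n → (∀ {i} → i < n → P (2 ^ suc i)) → All P (twoPowers n)
All-twoPowers zero _ = []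
All-twoPowers (suc n) P-2^[1+i] = P-2^[1+i] ≤-refl ∷ All-twoPowers n (P-2^[1+i] ∘ m<n⇒m<1+n)

twoPowers-unique : ∀ n → Unique (twoPowers n)
twoPowers-unique zero = []
twoPowers-unique (suc n) =
  All-twoPowers n (λ i<n → >⇒≢ (^-monoʳ-< 2 (s≤s (s≤s z≤n)) (s≤s i<n))) ∷ twoPowers-unique n

∈-twoPowers : ∀ {n i} → i < n → 2 ^ suc i ∈ twoPowers n
∈-twoPowers {suc n} i<1+n with m<1+n⇒m<n∨m≡n i<1+n
... | inj₁ i<n = there (∈-twoPowers i<n)
... | inj₂ refl = here refl

twoPowers-InA : ∀ p n → All (λ s → InA p s × s ≢ 1) (twoPowers n)
twoPowers-InA p n = All-twoPowers n (λ {i} _ → InA-2^ p (suc i) , even≢odd (2 ^ i) 0)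

odd∷twoPowers-unique : ∀ q n → Unique (suc (2 * q) ∷ twoPowers n)
odd∷twoPowers-unique q n = All-twoPowers n (λ {i} _ → even≢odd (2 ^ i) q ∘ sym) ∷ twoPowers-unique n

maxList-twoPowers : ∀ n → maxList (twoPowers n) ≤ 2 ^ n
maxList-twoPowers zero = z≤n
maxList-twoPowers (suc n) =
  ⊔-lub ≤-refl (≤-trans (maxList-twoPowers n) (^-monoʳ-≤ 2 (n≤1+n n)))

module _ {S : List ℕ} {x : ℕ} (y : ℕ) where

  SumOfDistinct-skip : SumOfDistinct S x → SumOfDistinct (y ∷ S) x
  SumOfDistinct-skip (T , T⊆S , ΣT≡x) = T , y ∷ʳ T⊆S , ΣT≡x

  SumOfDistinct-take : SumOfDistinct S x → SumOfDistinct (y ∷ S) (y + x)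
  SumOfDistinct-take (T , T⊆S , ΣT≡x) = y ∷ T , refl ∷ T⊆S , cong (y +_) ΣT≡x

twoPowers-sumsOfDistinct : ∀ n {m} → m < 2 ^ n → SumOfDistinct (twoPowers n) (2 * m)
twoPowers-sumsOfDistinct zero {zero} _ = [] , [] , refl
twoPowers-sumsOfDistinct zero {suc _} (s≤s ())
twoPowers-sumsOfDistinct (suc n) {m} m<2^[1+n] with m <? 2 ^ n
... | yes m<2^n = SumOfDistinct-skip _ (twoPowers-sumsOfDistinct n m<2^n)
... | no m≮2^n with m≤n⇒∃[o]m+o≡n (≮⇒≥ m≮2^n)
...   | r , refl =
  subst (SumOfDistinct _) (sym (*-distribˡ-+ 2 (2 ^ n) r))
    (SumOfDistinct-take _ (twoPowers-sumsOfDistinct n r<2^n))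
  where
  r<2^n : r < 2 ^ n
  r<2^n = +-cancelˡ-< (2 ^ n) r (2 ^ n) (subst (2 ^ n + r <_) (2*m≡m+m (2 ^ n)) m<2^[1+n])

odd∷twoPowers-sumsOfDistinct : ∀ q n → suc (2 * q) ≤ 2 ^ n →
  ∀ {x} → 2 * q ≤ x → x ≤ 2 * q + suc n → SumOfDistinct (suc (2 * q) ∷ twoPowers n) x
odd∷twoPowers-sumsOfDistinct q n 1+2q≤2^n 2q≤x x≤2q+1+n with m≤n⇒∃[o]m+o≡n 2q≤x
... | y , refl with even⊎odd y
...   | r , inj₁ refl =
  SumOfDistinct-skip _ (subst (SumOfDistinct _) (*-distribˡ-+ 2 q r)
    (twoPowers-sumsOfDistinct n (*-cancelˡ-< 2 (q + r) (2 ^ n) 2[q+r]<2^[1+n])))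
  where
  open ≤-Reasoning
  2[q+r]<2^[1+n] : 2 * (q + r) < 2 ^ suc n
  2[q+r]<2^[1+n] = begin-strict
    2 * (q + r)    ≡⟨ *-distribˡ-+ 2 q r ⟩
    2 * q + 2 * r  ≤⟨ x≤2q+1+n ⟩
    2 * q + suc n  ≤⟨ +-monoʳ-≤ (2 * q) (n<2^n n) ⟩
    2 * q + 2 ^ n  <⟨ +-monoˡ-< (2 ^ n) 1+2q≤2^n ⟩
    2 ^ n + 2 ^ n  ≡⟨ 2*m≡m+m (2 ^ n) ⟨
    2 ^ suc n      ∎
...   | r , inj₂ refl =
  subst (SumOfDistinct _) (sym (+-suc (2 * q) (2 * r)))
    (SumOfDistinct-take _ (twoPowers-sumsOfDistinct n r<2^n))
  where
  open ≤-Reasoning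
  r<2^n : r < 2 ^ n
  r<2^n = begin-strict
    r      ≤⟨ m≤n*m r 2 ⟩
    2 * r  ≤⟨ s≤s⁻¹ (+-cancelˡ-≤ (2 * q) _ _ x≤2q+1+n) ⟩
    n      <⟨ n<2^n n ⟩
    2 ^ n  ∎

lemma2 : (p : ℕ) → 1 < p → ¬ (2 ∣ p) →
    ∃[ S ] (Unique S × All (λ s → InA p s × s ≢ 1) S
      × (∀ j → 1 ≤ j → 2 ^ j ≤ length S → 2 ^ j ∈ S)
      × (∃[ M₀ ] (1 ≤ M₀ × M₀ ≤ p
          × (∀ x → M₀ ≤ x → x ≤ M₀ + length S → SumOfDistinct S x)))
      × length S ≤ 1 + ⌈log₂ p ⌉
      × p ≤ maxList S × maxList S ≤ 2 ^ ⌈log₂ p ⌉)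
lemma2 p 1<p 2∤p with ¬2∣⇒odd 2∤p
... | q , refl =
  S , odd∷twoPowers-unique q k , (InA-self p , >⇒≢ 1<p) ∷ twoPowers-InA p k ,
  powersOfTwo∈S , (2 * q , s≤s⁻¹ 1<p , n≤1+n (2 * q) , sums) ,
  ≤-reflexive |S|≡1+k , m≤m⊔n p (maxList (twoPowers k)) , ⊔-lub p≤2^k (maxList-twoPowers k)
  where
  k : ℕ
  k = ⌈log₂ p ⌉

  S : List ℕ
  S = p ∷ twoPowers k

  |S|≡1+k : length S ≡ suc k
  |S|≡1+k = cong suc (length-twoPowers k)

  p≤2^k : p ≤ 2 ^ k
  p≤2^k = n≤2^⌈log₂n⌉ p

  powersOfTwo∈S : ∀ j → 1 ≤ j → 2 ^ j ≤ length S → 2 ^ j ∈ S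
  powersOfTwo∈S (suc i) _ 2^[1+i]≤|S| =
    there (∈-twoPowers (s≤s⁻¹ (<-≤-trans (n<2^n (suc i)) 2^[1+i]≤1+k)))
    where
    2^[1+i]≤1+k : 2 ^ suc i ≤ suc k
    2^[1+i]≤1+k = ≤-trans 2^[1+i]≤|S| (≤-reflexive |S|≡1+k)

  sums : ∀ x → 2 * q ≤ x → x ≤ 2 * q + length S → SumOfDistinct S x
  sums x 2q≤x x≤2q+|S| =
    odd∷twoPowers-sumsOfDistinct q k p≤2^k 2q≤x (subst (λ l → x ≤ 2 * q + l) |S|≡1+k x≤2q+|S|)
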